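{- Let $f:2^V\to\mathbb{R}$ be a submodular function that has a $k$-sparse minimizer. If an element $p\in V$ lies in every $k$-sparse minimizer of $f$, then $p$ lies in every minimizer of $f$.
   Context: A $k$-sparse minimizer of $f$ is a set $S\in\arg\min_{T\subseteq V}f(T)$ with $|S|\le k$. -}

module Defs where

open import Level using (Level; suc; _⊔_)
open import Data.Nat using (ℕ) renaming (_≤_ to _≤ℕ_)
open import Data.Fin using (Fin)
open import Data.Fin.Subset using (Subset; _∪_; _∩_; ∣_∣)
open import Data.Product using (_×_)
open import Relation.Binary.PropositionalEquality using (_≡_)
open import Relation.Binary.Structures using (IsTotalOrder)
open import Algebra.Structures using (IsAbelianGroup)

-- The standard library has no real numbers.  We take the codomain of f to be
-- an arbitrary totally ordered abelian group (ℝ with + and ≤ is one).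
record OrderedAbelianGroup (c ℓ : Level) : Set (suc (c ⊔ ℓ)) where
  infixl 6 _+_
  infix 4 _≤_
  field
    Carrier        : Set c
    _+_            : Carrier → Carrier → Carrier
    0#             : Carrier
    -_             : Carrier → Carrier
    _≤_            : Carrier → Carrier → Set ℓ
    isAbelianGroup : IsAbelianGroup _≡_ _+_ 0# -_
    isTotalOrder   : IsTotalOrder _≡_ _≤_
    +-monoˡ-≤      : ∀ {x y} z → x ≤ y → x + z ≤ y + z

module _ {c ℓ : Level} (G : OrderedAbelianGroup c ℓ) {n : ℕ} where
  open OrderedAbelianGroup G

  Submodular : (Subset n → Carrier) → Set ℓ
  Submodular f = ∀ S T → f (S ∪ T) + f (S ∩ T) ≤ f S + f T

  IsMinimizer : (Subset n → Carrier) → Subset n → Set ℓ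
  IsMinimizer f S = ∀ T → f S ≤ f T

  IsSparseMinimizer : ℕ → (Subset n → Carrier) → Subset n → Set ℓ
  IsSparseMinimizer k f S = IsMinimizer f S × ∣ S ∣ ≤ℕ k

{-# OPTIONS --safe #-}
module Submission where

open import Defs
open import Level using (Level)
open import Data.Nat using (ℕ)
open import Data.Nat.Properties using (≤-trans)
open import Data.Fin using (Fin)
open import Data.Fin.Subset using (Subset; _∈_; _∩_; _∪_)
open import Data.Fin.Subset.Properties using (∣p∩q∣≤∣q∣; x∈p∩q⁻)
open import Data.Product using (∃; _,_; proj₁)
open import Relation.Binary.PropositionalEquality using (_≡_; subst₂; cong; sym)
open import Relation.Binary.Structures using (IsTotalOrder)
open import Relation.Binary.Bundles using (Poset)
open import Algebra.Structures using (IsAbelianGroup)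
import Relation.Binary.Reasoning.PartialOrder as PosetReasoning

-- Minimizers of a submodular function are closed under intersection, since
-- f (S ∪ T) + f (S ∩ T) ≤ f S + f T and f (S ∪ T) cannot undercut the minimum.
-- Intersecting any minimizer S with a k-sparse one gives a k-sparse minimizer,
-- which contains p, so S does too.

module OrderedAbelianGroupProperties {c ℓ : Level} (G : OrderedAbelianGroup c ℓ) where
  open OrderedAbelianGroup G
  open IsAbelianGroup isAbelianGroup using (assoc; comm; inverseʳ; identityʳ)
  open IsTotalOrder isTotalOrder using (isPartialOrder)

  ≤-poset : Poset c c ℓ
  ≤-poset = record { isPartialOrder = isPartialOrder }

  open PosetReasoning ≤-poset

  +-monoʳ-≤ : ∀ {x y} z → x ≤ y → z + x ≤ z + y
  +-monoʳ-≤ {x} {y} z x≤y = subst₂ _≤_ (comm x z) (comm y z) (+-monoˡ-≤ z x≤y)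

  x+z-z≡x : ∀ x z → (x + z) + - z ≡ x
  x+z-z≡x x z = begin-equality
    (x + z) + - z  ≡⟨ assoc x z (- z) ⟩
    x + (z + - z)  ≡⟨ cong (x +_) (inverseʳ z) ⟩
    x + 0#         ≡⟨ identityʳ x ⟩
    x              ∎

  +-cancelˡ-≤ : ∀ z {x y} → z + x ≤ z + y → x ≤ y
  +-cancelˡ-≤ z {x} {y} z+x≤z+y = begin
    x              ≡⟨ sym (x+z-z≡x x z) ⟩
    (x + z) + - z  ≤⟨ +-monoˡ-≤ (- z) (subst₂ _≤_ (comm z x) (comm z y) z+x≤z+y) ⟩
    (y + z) + - z  ≡⟨ x+z-z≡x y z ⟩
    y              ∎

module _ {c ℓ : Level} (G : OrderedAbelianGroup c ℓ) {n : ℕ}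
         {f : Subset n → OrderedAbelianGroup.Carrier G} where
  open OrderedAbelianGroup G
  open OrderedAbelianGroupProperties G
  open PosetReasoning ≤-poset

  minimizer-∩ : Submodular G f → ∀ {S T} → IsMinimizer G f S → IsMinimizer G f T →
                IsMinimizer G f (S ∩ T)
  minimizer-∩ submodular {S} {T} minS minT U = begin
    f (S ∩ T)  ≤⟨ +-cancelˡ-≤ (f S) fS+f∩≤fS+fS ⟩
    f S        ≤⟨ minS U ⟩
    f U        ∎
    where
    fS+f∩≤fS+fS : f S + f (S ∩ T) ≤ f S + f S
    fS+f∩≤fS+fS = begin
      f S + f (S ∩ T)        ≤⟨ +-monoˡ-≤ (f (S ∩ T)) (minS (S ∪ T)) ⟩
      f (S ∪ T) + f (S ∩ T)  ≤⟨ submodular S T ⟩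
      f S + f T              ≤⟨ +-monoʳ-≤ (f S) (minT S) ⟩
      f S + f S              ∎

  sparseMinimizer-∩ : Submodular G f → ∀ {k S T} → IsMinimizer G f S →
                      IsSparseMinimizer G k f T → IsSparseMinimizer G k f (S ∩ T)
  sparseMinimizer-∩ submodular {S = S} {T} minS (minT , ∣T∣≤k) =
    minimizer-∩ submodular minS minT , ≤-trans (∣p∩q∣≤∣q∣ S T) ∣T∣≤k

claim4p7 : {c ℓ : Level} (G : OrderedAbelianGroup c ℓ) (n : ℕ)
    (f : Subset n → OrderedAbelianGroup.Carrier G) (k : ℕ) →
    Submodular G f →
    ∃ (λ S → IsSparseMinimizer G k f S) →
    (p : Fin n) →
    (∀ S → IsSparseMinimizer G k f S → p ∈ S) →
    ∀ S → IsMinimizer G f S → p ∈ S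
claim4p7 G n f k submodular (S₀ , sparseS₀) p p∈sparse S minS =
  proj₁ (x∈p∩q⁻ S S₀ (p∈sparse (S ∩ S₀) (sparseMinimizer-∩ G submodular minS sparseS₀)))
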